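{- Let $\mathcal{B}$ be an oplax covariant lens over a reflexive graph $\mathcal{A}$ that has universal pushforwards. Then the display $\mathsf{disp}^+_{\mathcal{A}}\mathcal{B}$ is a covariant fibration, and for $p:x\approx_{\mathcal{A}}y$ and $u:|\mathcal{B}(x)|$ the centre of contraction of $\sum_{v}u\approx_pv$ can be chosen to be $(\mathsf{push}_pu,\ \mathsf{rx}_{\mathcal{B}(y)}(\mathsf{push}_pu))$.
   Context: Intensional Martin-Löf type theory with $\Pi,\Sigma$, identity types. A reflexive graph $\mathcal{G}$: vertex type $|\mathcal{G}|$, edge types $x\approx_{\mathcal{G}}y$, $\mathsf{rx}_{\mathcal{G}}(x):x\approx_{\mathcal{G}}x$; the fan of $x$ is $\sum_yx\approx_{\mathcal{G}}y$. An oplax covariant lens over $\mathcal{A}$: family of reflexive graphs $\mathcal{B}(x)$ ($x:|\mathcal{A}|$), $\mathsf{push}_p:|\mathcal{B}(x)|\to|\mathcal{B}(y)|$ for $p:x\approx_{\mathcal{A}}y$, and $\mathsf{pushRx}_x(u):\mathsf{push}_{\mathsf{rx}_{\mathcal{A}}(x)}u\approx_{\mathcal{B}(x)}u$. It has universal pushforwards if for every $p:x\approx_{\mathcal{A}}y$ and $u:|\mathcal{B}(x)|$ the fan of $\mathsf{push}_pu$ in $\mathcal{B}(y)$ is a proposition. Its display $\mathsf{disp}^+_{\mathcal{A}}\mathcal{B}$ is the displayed reflexive graph over $\mathcal{A}$ with displayed vertices $|\mathcal{B}(x)|$, displayed edges $u\approx_pv:=\mathsf{push}_pu\approx_{\mathcal{B}(y)}v$,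 and displayed reflexivity $\mathsf{pushRx}_x(u)$. A displayed reflexive graph over $\mathcal{A}$ (with displayed edge types $u\approx_pv$ for $p:x\approx_{\mathcal{A}}y$) is a covariant fibration if for all $p:x\approx_{\mathcal{A}}y$ and displayed vertices $u$ over $x$, the type $\sum_{v}u\approx_pv$ (over displayed vertices $v$ over $y$) is contractible. -}

{-# OPTIONS --without-K #-}
module Defs where

open import Level using (Level; _⊔_; suc)
open import Data.Product using (Σ; _,_; proj₁; proj₂)
open import Relation.Binary.PropositionalEquality using (_≡_)

isContr : ∀ {ℓ} → Set ℓ → Set ℓ
isContr A = Σ A λ c → (x : A) → c ≡ x

centre : ∀ {ℓ} {A : Set ℓ} → isContr A → A
centre = proj₁

isProp : ∀ {ℓ} → Set ℓ → Set ℓ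
isProp A = (x y : A) → x ≡ y

record RGraph (ℓ₀ ℓ₁ : Level) : Set (suc (ℓ₀ ⊔ ℓ₁)) where
  field
    Vtx : Set ℓ₀
    Edge : Vtx → Vtx → Set ℓ₁
    rx : (x : Vtx) → Edge x x

open RGraph public

Fan : ∀ {ℓ₀ ℓ₁} (G : RGraph ℓ₀ ℓ₁) → Vtx G → Set (ℓ₀ ⊔ ℓ₁)
Fan G x = Σ (Vtx G) λ y → Edge G x y

record DispRGraph {ℓ₀ ℓ₁} (A : RGraph ℓ₀ ℓ₁) (ℓ₂ ℓ₃ : Level)
       : Set (ℓ₀ ⊔ ℓ₁ ⊔ suc (ℓ₂ ⊔ ℓ₃)) where
  field
    DVtx : Vtx A → Set ℓ₂
    DEdge : {x y : Vtx A} → Edge A x y → DVtx x → DVtx y → Set ℓ₃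
    drx : {x : Vtx A} (u : DVtx x) → DEdge (rx A x) u u

open DispRGraph public

isCovFib : ∀ {ℓ₀ ℓ₁ ℓ₂ ℓ₃} {A : RGraph ℓ₀ ℓ₁} → DispRGraph A ℓ₂ ℓ₃ → Set (ℓ₀ ⊔ ℓ₁ ⊔ ℓ₂ ⊔ ℓ₃)
isCovFib {A = A} D =
  {x y : Vtx A} (p : Edge A x y) (u : DVtx D x) →
  isContr (Σ (DVtx D y) λ v → DEdge D p u v)

record OplaxCovLens {ℓ₀ ℓ₁} (A : RGraph ℓ₀ ℓ₁) (ℓ₂ ℓ₃ : Level)
       : Set (ℓ₀ ⊔ ℓ₁ ⊔ suc (ℓ₂ ⊔ ℓ₃)) where
  field
    Fib : Vtx A → RGraph ℓ₂ ℓ₃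
    push : {x y : Vtx A} → Edge A x y → Vtx (Fib x) → Vtx (Fib y)
    pushRx : (x : Vtx A) (u : Vtx (Fib x)) → Edge (Fib x) (push (rx A x) u) u

open OplaxCovLens public

HasUniversalPushforwards : ∀ {ℓ₀ ℓ₁ ℓ₂ ℓ₃} {A : RGraph ℓ₀ ℓ₁} → OplaxCovLens A ℓ₂ ℓ₃ → Set (ℓ₀ ⊔ ℓ₁ ⊔ ℓ₂ ⊔ ℓ₃)
HasUniversalPushforwards {A = A} B =
  {x y : Vtx A} (p : Edge A x y) (u : Vtx (Fib B x)) →
  isProp (Fan (Fib B y) (push B p u))

disp⁺ : ∀ {ℓ₀ ℓ₁ ℓ₂ ℓ₃} {A : RGraph ℓ₀ ℓ₁} → OplaxCovLens A ℓ₂ ℓ₃ → DispRGraph A ℓ₂ ℓ₃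
disp⁺ {A = A} B = record
  { DVtx = λ x → Vtx (Fib B x)
  ; DEdge = λ {x} {y} p u v → Edge (Fib B y) (push B p u) v
  ; drx = λ {x} u → pushRx B x u
  }

{-# OPTIONS --without-K #-}
module Submission where

open import Defs
open import Data.Product using (Σ; _,_)
open import Relation.Binary.PropositionalEquality using (_≡_; refl)

-- The displayed edges u ≈ₚ v of disp⁺ B are by definition the edges push p u ≈ v,
-- so Σ v, u ≈ₚ v is literally the fan of push p u, which contains its reflexivity edge.

inhabited-isProp⇒isContr : ∀ {ℓ} {X : Set ℓ} → X → isProp X → isContr X
inhabited-isProp⇒isContr c X-prop = c , X-prop c

fan-isContr : ∀ {ℓ₀ ℓ₁} (G : RGraph ℓ₀ ℓ₁) (x : Vtx G) →
  isProp (Fan G x) → isContr (Fan G x)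
fan-isContr G x = inhabited-isProp⇒isContr (x , rx G x)

mainTheorem7 : ∀ {ℓ₀ ℓ₁ ℓ₂ ℓ₃} {A : RGraph ℓ₀ ℓ₁} (B : OplaxCovLens A ℓ₂ ℓ₃) →
    HasUniversalPushforwards B →
    Σ (isCovFib (disp⁺ B)) λ fib →
    {x y : Vtx A} (p : Edge A x y) (u : Vtx (Fib B x)) →
    centre (fib p u) ≡ (push B p u , rx (Fib B y) (push B p u))
mainTheorem7 B universal =
  (λ {_} {y} p u → fan-isContr (Fib B y) (push B p u) (universal p u)) ,
  λ p u → refl
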